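{- For every predicate $P$, $$\mathbf{R1}(\mathbf{R2}_c(P)) = \big(\exists t \in \mathcal{T}.\ P[\langle\rangle, t / tr, tr'] \land tr' = tr \frown t\big).$$
   Context: Fix a trace algebra $(\mathcal{T}, \frown, \langle\rangle)$: a set with associative $\frown$, two-sided unit $\langle\rangle$, left and right cancellation, and $x \frown y = \langle\rangle \Rightarrow x = \langle\rangle$. Prefix: $x \le y \iff \exists z.\ y = x \frown z$; subtraction: $y - x$ is the unique $z$ with $y = x \frown z$ if $x \le y$, else $\langle\rangle$. Predicates are relations (formulas identified up to logical equivalence) over unprimed and primed variables, including $tr, tr' : \mathcal{T}$ (and possibly $wait, wait'$ and other state variables); $t$ is a fresh variable. Conditional: $P \lhd b \rhd Q \triangleq (b \land P) \lor (\lnot b \land Q)$. $\mathbf{R1}(P) \triangleq P \land tr \le tr'$; $\mathbf{R2}_c(P) \triangleq P[\langle\rangle, tr' - tr / tr, tr'] \lhd tr \le tr' \rhd P$ (simultaneous substitution). -}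

module Defs where

open import Level using (0ℓ)
open import Data.Product using (Σ; ∃; _×_; _,_)
open import Data.Sum using (_⊎_)
open import Relation.Nullary using (¬_)
open import Relation.Binary.PropositionalEquality using (_≡_)

-- Trace subtraction y - x is carried as an operation together with its
-- defining specification (the unique z with y = x ⁀ z when x ≤ y, else ⟨⟩;
-- uniqueness follows from left cancellation).
record TraceAlgebra : Set₁ where
  infixr 6 _⁀_
  field
    T       : Set
    _⁀_     : T → T → T
    ⟨⟩      : T
    assoc   : ∀ x y z → (x ⁀ y) ⁀ z ≡ x ⁀ (y ⁀ z)
    identityˡ : ∀ x → ⟨⟩ ⁀ x ≡ x
    identityʳ : ∀ x → x ⁀ ⟨⟩ ≡ x
    cancelˡ : ∀ x y z → x ⁀ y ≡ x ⁀ z → y ≡ z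
    cancelʳ : ∀ x y z → y ⁀ x ≡ z ⁀ x → y ≡ z
    nonneg  : ∀ x y → x ⁀ y ≡ ⟨⟩ → x ≡ ⟨⟩

  _≤_ : T → T → Set
  x ≤ y = Σ T (λ z → y ≡ x ⁀ z)

  field
    _-_     : T → T → T
    sub-≤   : ∀ x y → x ≤ y → y ≡ x ⁀ (y - x)
    sub-≰   : ∀ x y → ¬ (x ≤ y) → y - x ≡ ⟨⟩

module Predicates (𝒯 : TraceAlgebra) (V : Set) where
  open TraceAlgebra 𝒯

  -- A predicate: a relation over tr, tr' and the remaining (unprimed and
  -- primed) variables, whose joint valuation is an element of V.
  Pred : Set₁
  Pred = T → T → V → Set

  _≐_ : Pred → Pred → Set
  P ≐ Q = ∀ tr tr' v → (P tr tr' v → Q tr tr' v) × (Q tr tr' v → P tr tr' v)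

  cond : Pred → Pred → Pred → Pred
  cond P b Q tr tr' v = (b tr tr' v × P tr tr' v) ⊎ (¬ b tr tr' v × Q tr tr' v)

  tr≤tr' : Pred
  tr≤tr' tr tr' v = tr ≤ tr'

  R1 : Pred → Pred
  R1 P tr tr' v = P tr tr' v × tr ≤ tr'

  R2c : Pred → Pred
  R2c P = cond (λ tr tr' v → P ⟨⟩ (tr' - tr) v) tr≤tr' P

  R1R2c-rhs : Pred → Pred
  R1R2c-rhs P tr tr' v = Σ T (λ t → P ⟨⟩ t v × tr' ≡ tr ⁀ t)

module Submission where

open import Defs
open import Data.Product using (_,_)
open import Data.Sum using (inj₁; inj₂)
open import Relation.Nullary using (contradiction)
open import Relation.Binary.PropositionalEquality using (_≡_; sym; trans; subst)

-- Under R1 only the substituted branch of R2c survives, and its trace tr' - tr is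
-- the extension t with tr' = tr ⁀ t; by left cancellation it is the only one.

module _ (𝒯 : TraceAlgebra) where
  open TraceAlgebra 𝒯

  minus-unique : ∀ x y t → y ≡ x ⁀ t → y - x ≡ t
  minus-unique x y t y≡x⁀t =
    cancelˡ x (y - x) t (trans (sym (sub-≤ x y (t , y≡x⁀t))) y≡x⁀t)

theorem10 : (𝒯 : TraceAlgebra) (V : Set) (P : Predicates.Pred 𝒯 V) → Predicates._≐_ 𝒯 V (Predicates.R1 𝒯 V (Predicates.R2c 𝒯 V P)) (Predicates.R1R2c-rhs 𝒯 V P)
theorem10 𝒯 V P tr tr' v = forward , backward
  where
  open TraceAlgebra 𝒯
  open Predicates 𝒯 V

  forward : R1 (R2c P) tr tr' v → R1R2c-rhs P tr tr' v
  forward (inj₁ (le , p) , _)   = tr' - tr , p , sub-≤ tr tr' le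
  forward (inj₂ (nle , _) , le) = contradiction le nle

  backward : R1R2c-rhs P tr tr' v → R1 (R2c P) tr tr' v
  backward (t , p , tr'≡tr⁀t) = inj₁ (le , p′) , le
    where
    le : tr ≤ tr'
    le = t , tr'≡tr⁀t

    p′ : P ⟨⟩ (tr' - tr) v
    p′ = subst (λ s → P ⟨⟩ s v) (sym (minus-unique 𝒯 tr tr' t tr'≡tr⁀t)) p
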